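{- Let $\alpha$ be a non-null restricted growth string of length $L$, and for each $k>L$ let $\alpha_k$ denote the $k$-germ obtained by prefixing $k-1-L$ zeros to $\alpha$; note $i=i(\alpha_k)$ does not depend on $k$. Then there is an integer $\ell\ge 0$, depending only on $\alpha$ and not on $k$, such that either $A_{i}(\alpha_k)=\ell$ for every $k>L$ (this is the case when the substring $kk$ of $F(\alpha_k)$ lies in the moved block $Y$ of the castling producing $F(\alpha_k)$ from its parent), or $A_{i}(\alpha_k)=k-\ell$ for every $k>L$ (the case when $kk$ lies in the block $X$). Consequently the single updated signature value $A_{i(\alpha)}$ at each non-root node is encoded, universally for all $k$, by $\ell$ or $-\ell$.
   Context: A restricted growth string (RGS) is a string $b_{m}\cdots b_1$ with $b_m=1$ and $0\le b_{i-1}\le b_i+1$ (the null RGS is $0$). A $k$-germ ($k\ge 2$) is a string $\alpha=a_{k-1}a_{k-2}\cdots a_1$ of nonnegative integers with $a_{k-1}\in\{0,1\}$ and $0\le a_{i-1}\le a_i+1$ for $1<i<k$. For $\alpha\neq 0^{k-1}$ let $i(\alpha)$ be the index of the rightmost nonzero entry of $\alpha$, and let the parent $\beta$ of $\alpha$ be the $k$-germ equal to $\alpha$ except that $b_{i(\alpha)}=a_{i(\alpha)}-1$; this makes the $k$-germs the nodes of a tree $\mathcal T_k$ rooted at $0^{k-1}$. The $n$-nest $F(\alpha)$ ($n=2k+1$) is defined recursively along $\mathcal T_k$: $F(0^{k-1})=0\,1\,2\cdots(k-1)\,k\,k\,(k-1)\cdots 2\,1$; for $\alpha\ne 0^{k-1}$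 with parent $\beta$ and $i=i(\alpha)$, write $F(\beta)=W^i|M|Z^i$ where $W^i$, $Z^i$ are the leftmost and rightmost substrings of length $i$, let $c$ be the leftmost entry of $M$, and split $M=X|Y$ where $Y$ starts at the (leftmost) entry equal to $c+1$ in $M$; then $F(\alpha)=W^i|Y|X|Z^i$. Each $j\in[1,k]$ appears exactly twice in $F(\alpha)$, at positions $p_j<q_j$; the signature entries are $A_j(\alpha)=\lfloor (q_j-p_j)/2\rfloor$ for $j\in[1,k-1]$ (the number of integers both of whose appearances lie strictly between the two appearances of $j$). -}

module Defs where

open import Data.Nat using (ℕ; zero; suc; _+_; _∸_; _≤_; _≡ᵇ_; _/_)
open import Data.List using (List; []; _∷_; _++_; take; drop; length; replicate; reverse; breakᵇ)
open import Data.Nat.ListAction using (sum)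
open import Data.List.Relation.Unary.Linked using (Linked)
open import Data.Bool using (true; false)
open import Data.Maybe using (Maybe; just; nothing)
open import Data.Product using (_×_; _,_; ∃)
open import Relation.Binary.PropositionalEquality using (_≡_)

-- Strings are written as lists in the paper's left-to-right order:
-- the RGS b_m ⋯ b_1 is the list b_m ∷ ⋯ ∷ b_1 ∷ [], and the k-germ
-- a_{k-1} ⋯ a_1 is the list a_{k-1} ∷ ⋯ ∷ a_1 ∷ [] (length k-1).

NonNullRGS : List ℕ → Set
NonNullRGS α = (∃ λ rest → α ≡ 1 ∷ rest) × Linked (λ x y → y ≤ suc x) α

pad : ℕ → List ℕ → List ℕ
pad k α = replicate (k ∸ 1 ∸ length α) 0 ++ α

-- On the REVERSED germ a_1 ∷ a_2 ∷ ⋯ : if not all zero, return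
-- (i(α), parent), where the parent decrements the rightmost nonzero entry.
stepR : List ℕ → Maybe (ℕ × List ℕ)
stepR [] = nothing
stepR (zero ∷ xs) with stepR xs
... | nothing = nothing
... | just (i , β) = just (suc i , zero ∷ β)
stepR (suc a ∷ xs) = just (1 , a ∷ xs)

-- i(α) for a germ in paper order (index of rightmost nonzero entry, 1-based
-- from the right).  Returns 0 for the all-zero string (unused there).
iIdx : List ℕ → ℕ
iIdx α with stepR (reverse α)
... | nothing = 0
... | just (i , _) = i

-- F(0^{k-1}) = 0 1 2 ⋯ k k (k-1) ⋯ 1
up : ℕ → List ℕ
up zero = 0 ∷ []
up (suc n) = up n ++ (suc n ∷ [])

down : ℕ → List ℕ
down zero = []
down (suc n) = suc n ∷ down n

F0 : ℕ → List ℕ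
F0 k = up k ++ (k ∷ []) ++ down (k ∸ 1) ++ []

-- the castling step: F(β) = W^i | M | Z^i,  M = X | Y with Y starting at the
-- leftmost entry of M equal to c+1 (c = leftmost entry of M);
-- result W^i | Y | X | Z^i.
castle : ℕ → List ℕ → List ℕ
castle i w with drop i w
... | rest with take (length rest ∸ i) rest | drop (length rest ∸ i) rest
... | [] | Z = w
... | c ∷ M' | Z with breakᵇ (λ x → x ≡ᵇ suc c) (c ∷ M')
... | X , Y = take i w ++ Y ++ X ++ Z

-- F along the tree, on reversed germs, with fuel (= sum of entries).
FR : ℕ → ℕ → List ℕ → List ℕ
FR zero k α = F0 k
FR (suc n) k α with stepR α
... | nothing = F0 k
... | just (i , β) = castle i (FR n k β)

F : ℕ → List ℕ → List ℕ
F k α = FR (sum α) k (reverse α)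

positions : ℕ → List ℕ → List ℕ
positions j = go 0
  where
  go : ℕ → List ℕ → List ℕ
  go p [] = []
  go p (x ∷ xs) with x ≡ᵇ j
  ... | true = p ∷ go (suc p) xs
  ... | false = go (suc p) xs

-- A_j(α) = ⌊(q_j - p_j)/2⌋ computed on the k-germ α
-- (each j ∈ [1,k] occurs exactly twice in F(α); 0 returned otherwise).
A : ℕ → ℕ → List ℕ → ℕ
A k j α with positions j (F k α)
... | p ∷ q ∷ _ = (q ∸ p) / 2
... | _ = 0

{-# OPTIONS --safe #-}
-- For k > L, the values L+1, …, k of F(0^{k-1}) form a mountain (L+1) ⋯ k k ⋯ (L+1) in the
-- middle, and the castlings along the path from the root to α_k only ever cut the string at
-- the frames 0 ⋯ j, (j+1) ⋯ 1 with j < L and at a value ≤ L + 1. Each castling therefore moves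
-- the mountain as one block, to the same side of its cut for every k, so
-- F(α_k) = P ++ mountain ++ S with P and S independent of k. Since i(α) ≤ L, both copies of
-- i(α) lie in P or S: if they lie on the same side A_{i(α)} does not depend on k, otherwise
-- the distance between them grows by 2 with k and A_{i(α)} = k − ℓ.
-- That castling always finds c + 1 comes from the invariant F(α) ↭ F(0^{k-1}).
module Submission where

open import Defs
open import Data.Nat using (ℕ; zero; suc; _+_; _∸_; _≤_; _<_; _≡ᵇ_; _/_; z≤n; s≤s)
open import Data.Nat.Properties
open import Data.Nat.DivMod using (m/n≡1+[m∸n]/n; /-monoˡ-≤)
open import Data.Nat.ListAction using (sum)
open import Data.Nat.ListAction.Properties using (sum-++; sum-↭)
open import Data.List using (List; []; _∷_; _++_; take; drop; length; replicate; reverse; breakᵇ; map)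
open import Data.List.Properties
  using (length-++; ++-assoc; ++-identityʳ; reverse-++; unfold-reverse; length-reverse; ∷-injective)
open import Data.List.Membership.Propositional using (_∈_)
open import Data.List.Membership.Propositional.Properties using (∈-++⁺ˡ; ∈-++⁺ʳ; ∈-++⁻)
open import Data.List.Relation.Unary.All as All using (All; []; _∷_)
open import Data.List.Relation.Unary.All.Properties using (++⁺; ++⁻ˡ; ++⁻ʳ)
open import Data.List.Relation.Unary.Any using (here; there)
open import Data.List.Relation.Unary.Linked using (Linked; _∷_)
open import Data.List.Relation.Binary.Permutation.Propositional using (_↭_; ↭-sym; ↭-trans; ↭-reflexive)
open import Data.List.Relation.Binary.Permutation.Propositional.Properties
  using (∈-resp-↭; ↭-length; ↭-reverse; ++-comm) renaming (++⁺ˡ to ↭-++⁺ˡ; ++⁺ʳ to ↭-++⁺ʳ)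
open import Data.Bool using (true; false; T)
open import Data.Unit using (⊤; tt)
open import Data.Empty using (⊥-elim)
open import Data.Product as Prod using (∃; ∃₂; _×_; _,_; proj₁; proj₂)
open import Data.Sum using (_⊎_; inj₁; inj₂)
open import Data.Maybe using (just)
open import Relation.Nullary using (¬_; yes; no; contradiction)
open import Relation.Binary.PropositionalEquality
open import Function using (_∘_)

take-length-++ : ∀ {A : Set} (xs ys : List A) → take (length xs) (xs ++ ys) ≡ xs
take-length-++ [] ys = refl
take-length-++ (x ∷ xs) ys = cong (x ∷_) (take-length-++ xs ys)

drop-length-++ : ∀ {A : Set} (xs ys : List A) → drop (length xs) (xs ++ ys) ≡ ys
drop-length-++ [] ys = refl
drop-length-++ (x ∷ xs) ys = drop-length-++ xs ys

∉-if-all-< : ∀ {y} {xs : List ℕ} → All (_< y) xs → ¬ y ∈ xs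
∉-if-all-< all<y y∈xs = <-irrefl refl (All.lookup all<y y∈xs)

breakAt : ℕ → List ℕ → List ℕ × List ℕ
breakAt d = breakᵇ (λ x → x ≡ᵇ d)

≢⇒≡ᵇ≡false : ∀ {m n} → m ≢ n → (m ≡ᵇ n) ≡ false
≢⇒≡ᵇ≡false {m} {n} m≢n with m ≡ᵇ n in eq
... | true = contradiction (≡ᵇ⇒≡ m n (subst T (sym eq) tt)) m≢n
... | false = refl

≡ᵇ-refl : ∀ n → (n ≡ᵇ n) ≡ true
≡ᵇ-refl zero = refl
≡ᵇ-refl (suc n) = ≡ᵇ-refl n

breakAt-head : ∀ d xs → breakAt d (d ∷ xs) ≡ ([] , d ∷ xs)
breakAt-head d xs rewrite ≡ᵇ-refl d = refl

breakAt-≢ : ∀ {d x} xs → x ≢ d → breakAt d (x ∷ xs) ≡ Prod.map₁ (x ∷_) (breakAt d xs)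
breakAt-≢ xs x≢d rewrite ≢⇒≡ᵇ≡false x≢d = refl

breakAt-skip : ∀ {d} zs ys → All (_≢ d) zs → breakAt d (zs ++ ys) ≡ Prod.map₁ (zs ++_) (breakAt d ys)
breakAt-skip [] ys [] = refl
breakAt-skip (z ∷ zs) ys (z≢d ∷ zs≢d) =
  trans (breakAt-≢ (zs ++ ys) z≢d) (cong (Prod.map₁ (z ∷_)) (breakAt-skip zs ys zs≢d))

breakAt-++ : ∀ d xs → proj₁ (breakAt d xs) ++ proj₂ (breakAt d xs) ≡ xs
breakAt-++ d [] = refl
breakAt-++ d (x ∷ xs) with x ≡ᵇ d
... | true = refl
... | false = cong (x ∷_) (breakAt-++ d xs)

breakAt-∈ : ∀ {d} xs → d ∈ xs → ∃₂ λ X Y → breakAt d xs ≡ (X , d ∷ Y) × X ++ d ∷ Y ≡ xs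
breakAt-∈ {d} (x ∷ xs) d∈ with x ≟ d
... | yes refl = [] , xs , breakAt-head d xs , refl
... | no x≢d with d∈
...   | here d≡x = contradiction (sym d≡x) x≢d
...   | there d∈xs with breakAt-∈ xs d∈xs
...     | X , Y , brk , X++Y = x ∷ X , Y , trans (breakAt-≢ xs x≢d) (cong (Prod.map₁ (x ∷_)) brk) , cong (x ∷_) X++Y

castle-unfold : ∀ i w c M Z → drop i w ≡ (c ∷ M) ++ Z → length ((c ∷ M) ++ Z) ∸ i ≡ length (c ∷ M) →
  castle i w ≡ take i w ++ proj₂ (breakAt (suc c) (c ∷ M)) ++ proj₁ (breakAt (suc c) (c ∷ M)) ++ Z
castle-unfold i w c M Z drop≡ |M|≡ with drop i w | drop≡
... | ._ | refl with length ((c ∷ M) ++ Z) ∸ i | |M|≡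
... | ._ | refl rewrite take-length-++ M Z | drop-length-++ M Z = refl

castle-decomposed : ∀ W c M Z → length Z ≡ length W →
  castle (length W) (W ++ (c ∷ M) ++ Z) ≡
  W ++ proj₂ (breakAt (suc c) (c ∷ M)) ++ proj₁ (breakAt (suc c) (c ∷ M)) ++ Z
castle-decomposed W c M Z |Z|≡|W| = begin
  castle (length W) (W ++ (c ∷ M) ++ Z)
    ≡⟨ castle-unfold (length W) _ c M Z (drop-length-++ W _) |M|≡ ⟩
  take (length W) (W ++ (c ∷ M) ++ Z) ++ _
    ≡⟨ cong (_++ _) (take-length-++ W _) ⟩
  W ++ proj₂ (breakAt (suc c) (c ∷ M)) ++ proj₁ (breakAt (suc c) (c ∷ M)) ++ Z ∎
  where
  open ≡-Reasoning
  |M|≡ : length ((c ∷ M) ++ Z) ∸ length W ≡ length (c ∷ M)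
  |M|≡ = begin
    length ((c ∷ M) ++ Z) ∸ length W      ≡⟨ cong (_∸ length W) (length-++ (c ∷ M)) ⟩
    length (c ∷ M) + length Z ∸ length W ≡⟨ cong (λ n → length (c ∷ M) + n ∸ length W) |Z|≡|W| ⟩
    length (c ∷ M) + length W ∸ length W ≡⟨ m+n∸n≡m (length (c ∷ M)) (length W) ⟩
    length (c ∷ M)                        ∎

length-up : ∀ j → length (up j) ≡ suc j
length-up zero = refl
length-up (suc j) = trans (length-++ (up j)) (trans (cong (_+ 1) (length-up j)) (+-comm (suc j) 1))

length-down : ∀ j → length (down j) ≡ j
length-down zero = refl
length-down (suc j) = cong suc (length-down j)

up-≤ : ∀ j → All (_≤ j) (up j)
up-≤ zero = z≤n ∷ []
up-≤ (suc j) = ++⁺ (All.map m≤n⇒m≤1+n (up-≤ j)) (≤-refl ∷ [])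

down-≤ : ∀ j → All (_≤ j) (down j)
down-≤ zero = []
down-≤ (suc j) = ≤-refl ∷ All.map m≤n⇒m≤1+n (down-≤ j)

≤⇒∈-up : ∀ {x} k → x ≤ k → x ∈ up k
≤⇒∈-up zero z≤n = here refl
≤⇒∈-up (suc k) x≤k+1 with m≤n⇒m<n∨m≡n x≤k+1
... | inj₁ (s≤s x≤k) = ∈-++⁺ˡ (≤⇒∈-up k x≤k)
... | inj₂ refl = ∈-++⁺ʳ (up k) (here refl)

up-prefix : ∀ {t s} → t < s → ∃ λ u → up s ≡ up t ++ suc t ∷ u
up-prefix {t} {suc s} (s≤s t≤s) with m≤n⇒m<n∨m≡n t≤s
... | inj₂ refl = [] , refl
... | inj₁ t<s with up-prefix t<s
...   | u , eq = u ++ suc s ∷ [] , trans (cong (_++ suc s ∷ []) eq) (++-assoc (up t) (suc t ∷ u) (suc s ∷ []))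

down-suffix : ∀ {t s} → t ≤ s → ∃ λ d → down s ≡ d ++ down t
down-suffix {t} {s} t≤s with m≤n⇒m<n∨m≡n t≤s
... | inj₂ refl = [] , refl
down-suffix {t} {suc s} _ | inj₁ (s≤s t≤s) with down-suffix t≤s
...   | d , eq = suc s ∷ d , cong (suc s ∷_) eq

frame-≤ : ∀ {j c L} → j < c → c ≤ L → All (_≤ L) (up j) × All (_≤ L) (down (suc j))
frame-≤ {j} {c} {L} j<c c≤L =
  All.map (λ x≤j → ≤-trans x≤j (≤-trans (n≤1+n j) j<L)) (up-≤ j) ,
  All.map (λ x≤j → ≤-trans x≤j j<L) (down-≤ (suc j))
  where
  j<L : j < L
  j<L = ≤-trans j<c c≤L

castle-nest : ∀ j c M → castle (suc j) (up j ++ (c ∷ M) ++ down (suc j)) ≡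
  up j ++ proj₂ (breakAt (suc c) M) ++ (c ∷ proj₁ (breakAt (suc c) M)) ++ down (suc j)
castle-nest j c M = begin
  castle (suc j) (up j ++ (c ∷ M) ++ down (suc j))
    ≡⟨ cong (λ n → castle n (up j ++ (c ∷ M) ++ down (suc j))) (sym (length-up j)) ⟩
  castle (length (up j)) (up j ++ (c ∷ M) ++ down (suc j))
    ≡⟨ castle-decomposed (up j) c M (down (suc j)) (trans (length-down (suc j)) (sym (length-up j))) ⟩
  up j ++ proj₂ (breakAt (suc c) (c ∷ M)) ++ proj₁ (breakAt (suc c) (c ∷ M)) ++ down (suc j)
    ≡⟨ cong (λ b → up j ++ proj₂ b ++ proj₁ b ++ down (suc j)) (breakAt-≢ M (1+n≢n ∘ sym)) ⟩
  up j ++ proj₂ (breakAt (suc c) M) ++ (c ∷ proj₁ (breakAt (suc c) M)) ++ down (suc j) ∎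
  where open ≡-Reasoning

data Parent : List ℕ → ℕ → List ℕ → Set where
  decrement : ∀ a xs → Parent (suc a ∷ xs) 1 (a ∷ xs)
  skip-zero : ∀ {xs i β} → Parent xs i β → Parent (zero ∷ xs) (suc i) (zero ∷ β)

stepR-parent : ∀ {r i β} → Parent r i β → stepR r ≡ just (i , β)
stepR-parent (decrement a xs) = refl
stepR-parent (skip-zero p) rewrite stepR-parent p = refl

parent-exists : ∀ r {n} → sum r ≡ suc n → ∃₂ λ i β → Parent r i β
parent-exists (zero ∷ xs) sum≡ with parent-exists xs sum≡
... | i , β , p = suc i , zero ∷ β , skip-zero p
parent-exists (suc a ∷ xs) _ = 1 , a ∷ xs , decrement a xs

sum-parent : ∀ {r i β} → Parent r i β → sum r ≡ suc (sum β)
sum-parent (decrement a xs) = refl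
sum-parent (skip-zero p) = sum-parent p

parent-++ : ∀ {r i β} zs → Parent r i β → Parent (r ++ zs) i (β ++ zs)
parent-++ zs (decrement a xs) = decrement a (xs ++ zs)
parent-++ zs (skip-zero p) = skip-zero (parent-++ zs p)

parent-index-≤ : ∀ {r i β} → Parent r i β → i ≤ length r
parent-index-≤ (decrement a xs) = s≤s z≤n
parent-index-≤ (skip-zero p) = s≤s (parent-index-≤ p)

FR-parent : ∀ {r i β} n k → Parent r i β → FR (suc n) k r ≡ castle i (FR n k β)
FR-parent {r} n k p rewrite stepR-parent p = refl

-- For r = a_p ∷ a_{p+1} ∷ ⋯ : t + a_t ≤ k, so that the entry c + 1 = i + a_i that castling
-- looks for is one of the values of F0 k.
Bounded : ℕ → ℕ → List ℕ → Set
Bounded k p [] = ⊤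
Bounded k p (a ∷ r) = p + a ≤ k × Bounded k (suc p) r

bounded-parent : ∀ {r i β} k p → Parent r i β → Bounded k p r → Bounded k p β
bounded-parent k p (decrement a xs) (b , bs) = ≤-trans (+-monoʳ-≤ p (n≤1+n a)) b , bs
bounded-parent k p (skip-zero q) (b , bs) = b , bounded-parent k (suc p) q bs

-- For r = a_{t+1} ∷ a_{t+2} ∷ ⋯ : if a_i is the first nonzero entry then
-- F = 0 1 ⋯ (i-1) (i+a_i) ⋯ i (i-1) ⋯ 1, and F = F0 k if there is none.
Framed : ℕ → ℕ → List ℕ → List ℕ → Set
Framed t k [] F = F ≡ F0 k
Framed t k (zero ∷ r) F = Framed (suc t) k r F
Framed t k (suc b ∷ r) F = ∃ λ mid → F ≡ up t ++ (suc t + suc b) ∷ mid ++ down (suc t)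

framed-F0 : ∀ t k r → sum r ≡ 0 → Framed t k r (F0 k)
framed-F0 t k [] _ = refl
framed-F0 t k (zero ∷ r) sum≡0 = framed-F0 (suc t) k r sum≡0

F0-frame : ∀ {t k} → suc t < k → ∃ λ mid → F0 k ≡ up t ++ suc t ∷ mid ++ down (suc t)
F0-frame {t} {suc k} (s≤s t<k) with up-prefix {t} {suc k} (m≤n⇒m≤1+n t<k) | down-suffix t<k
... | u , up≡ | d , down≡ = u ++ suc k ∷ d , goal
  where
  goal : up (suc k) ++ (suc k ∷ []) ++ down k ++ [] ≡ up t ++ suc t ∷ (u ++ suc k ∷ d) ++ down (suc t)
  goal rewrite ++-identityʳ (down k) | up≡ | down≡
    | ++-assoc (up t) (suc t ∷ u) (suc k ∷ d ++ down (suc t))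
    | ++-assoc u (suc k ∷ d) (down (suc t)) = refl

framed-frame : ∀ {k s t} r F → t < s → suc t < k → Framed s k r F →
  ∃ λ mid → F ≡ up t ++ suc t ∷ mid ++ down (suc t)
framed-frame [] F t<s t+1<k refl = F0-frame t+1<k
framed-frame (zero ∷ r) F t<s t+1<k framed = framed-frame r F (m≤n⇒m≤1+n t<s) t+1<k framed
framed-frame {s = s} {t} (suc b ∷ r) F t<s t+1<k (mid , refl)
  with up-prefix t<s | down-suffix {suc t} {suc s} (m≤n⇒m≤1+n t<s)
... | u , up≡ | d , down≡ = u ++ (suc s + suc b) ∷ mid ++ d , goal
  where
  goal : up s ++ (suc s + suc b) ∷ mid ++ down (suc s) ≡
         up t ++ suc t ∷ (u ++ (suc s + suc b) ∷ mid ++ d) ++ down (suc t)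
  goal rewrite up≡ | down≡
    | ++-assoc (up t) (suc t ∷ u) ((suc s + suc b) ∷ mid ++ d ++ down (suc t))
    | ++-assoc u ((suc s + suc b) ∷ mid ++ d) (down (suc t))
    | ++-assoc mid d (down (suc t)) = refl

-- In the paper's notation: W^i = up j, c is the leftmost entry of M, and the castled
-- string begins its middle block with c + 1.
castling-site : ∀ {k t r i β F} → Parent r i β → Bounded k (suc t) r → Framed t k β F →
  ∃₂ λ j c → ∃ λ mid → (t + i ≡ suc j) × (suc j ≤ c) × (suc c ≤ k) ×
    (F ≡ up j ++ c ∷ mid ++ down (suc j)) ×
    (∀ mid′ → Framed t k r (up j ++ suc c ∷ mid′ ++ down (suc j)))
castling-site {k} {t} (decrement (suc a) xs) (b , _) (mid , F≡) =
  t , suc t + suc a , mid , +-comm t 1 , m≤m+n (suc t) (suc a) ,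
  subst (_≤ k) (+-suc (suc t) (suc a)) b , F≡ ,
  λ mid′ → mid′ , cong (λ v → up t ++ v ∷ mid′ ++ down (suc t)) (sym (+-suc (suc t) (suc a)))
castling-site {k} {t} {F = F} (decrement zero xs) (b , _) framed with subst (_≤ k) (+-comm (suc t) 1) b
... | t+2≤k with framed-frame xs F (n<1+n t) t+2≤k framed
... | mid , F≡ = t , suc t , mid , +-comm t 1 , ≤-refl , t+2≤k , F≡ ,
  λ mid′ → mid′ , cong (λ v → up t ++ v ∷ mid′ ++ down (suc t)) (sym (+-comm (suc t) 1))
castling-site {t = t} {i = suc i} (skip-zero p) (_ , bs) framed with castling-site p bs framed
... | j , c , mid , t+i≡ , rest = j , c , mid , trans (+-suc t i) t+i≡ , rest

Nest : ℕ → List ℕ → List ℕ → Set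
Nest k r F = F ↭ F0 k × Framed 0 k r F

nest-invariant : ∀ k n r → sum r ≡ n → Bounded k 1 r → Nest k r (FR n k r)
nest-invariant k zero r sum≡0 _ = ↭-reflexive refl , framed-F0 0 k r sum≡0
nest-invariant k (suc n) r sum≡ bounded with parent-exists r sum≡
... | i , β , p with sum-parent p
... | sum-r≡ with nest-invariant k n β (suc-injective (trans (sym sum-r≡) sum≡)) (bounded-parent k 1 p bounded)
... | perm , framed with castling-site p bounded framed
... | j , c , mid , refl , j<c , c<k , Fβ≡ , framed′ with breakAt-∈ mid c+1∈mid
  where
  c+1∈mid : suc c ∈ mid
  c+1∈mid with frame-≤ j<c ≤-refl
              | ∈-++⁻ (up j) (subst (suc c ∈_) Fβ≡ (∈-resp-↭ (↭-sym perm) (∈-++⁺ˡ (≤⇒∈-up k c<k))))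
  ... | up≤c , _ | inj₁ ∈up = ⊥-elim (∉-if-all-< (All.map s≤s up≤c) ∈up)
  ... | _ | inj₂ (here c+1≡c) = contradiction c+1≡c 1+n≢n
  ... | _ , down≤c | inj₂ (there ∈rest) with ∈-++⁻ mid ∈rest
  ...   | inj₁ ∈mid = ∈mid
  ...   | inj₂ ∈down = ⊥-elim (∉-if-all-< (All.map s≤s down≤c) ∈down)
... | X , Y , brk , X++Y = ↭-trans (↭-reflexive F≡) (↭-trans swapped (↭-trans (↭-reflexive (sym Fβ≡)) perm)) ,
                           subst (Framed 0 k r) (sym F≡) (framed′ (Y ++ c ∷ X))
  where
  open ≡-Reasoning
  F≡ : FR (suc n) k r ≡ up j ++ suc c ∷ (Y ++ c ∷ X) ++ down (suc j)
  F≡ = begin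
    FR (suc n) k r                                        ≡⟨ FR-parent n k p ⟩
    castle (suc j) (FR n k β)                             ≡⟨ cong (castle (suc j)) Fβ≡ ⟩
    castle (suc j) (up j ++ (c ∷ mid) ++ down (suc j))    ≡⟨ castle-nest j c mid ⟩
    up j ++ proj₂ (breakAt (suc c) mid) ++ (c ∷ proj₁ (breakAt (suc c) mid)) ++ down (suc j)
      ≡⟨ cong (λ b → up j ++ proj₂ b ++ (c ∷ proj₁ b) ++ down (suc j)) brk ⟩
    up j ++ suc c ∷ Y ++ (c ∷ X) ++ down (suc j)
      ≡⟨ cong (λ z → up j ++ suc c ∷ z) (sym (++-assoc Y (c ∷ X) _)) ⟩
    up j ++ suc c ∷ (Y ++ c ∷ X) ++ down (suc j)          ∎
  swapped : up j ++ suc c ∷ (Y ++ c ∷ X) ++ down (suc j) ↭ up j ++ c ∷ mid ++ down (suc j)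
  swapped = ↭-++⁺ˡ (up j) (↭-++⁺ʳ (down (suc j))
              (↭-trans (++-comm (suc c ∷ Y) (c ∷ X)) (↭-reflexive (cong (c ∷_) X++Y))))

mountain : ℕ → ℕ → List ℕ
mountain m zero = m ∷ m ∷ []
mountain m (suc g) = m ∷ mountain (suc m) g ++ m ∷ []

mountain-≥ : ∀ m g → All (m ≤_) (mountain m g)
mountain-≥ m zero = ≤-refl ∷ ≤-refl ∷ []
mountain-≥ m (suc g) = ≤-refl ∷ ++⁺ (All.map (≤-trans (n≤1+n m)) (mountain-≥ (suc m) g)) (≤-refl ∷ [])

length-mountain : ∀ m g → length (mountain m g) ≡ suc g + suc g
length-mountain m zero = refl
length-mountain m (suc g) = cong suc (begin
  length (mountain (suc m) g ++ m ∷ []) ≡⟨ length-++ (mountain (suc m) g) ⟩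
  length (mountain (suc m) g) + 1       ≡⟨ cong (_+ 1) (length-mountain (suc m) g) ⟩
  suc g + suc g + 1                     ≡⟨ trans (+-assoc (suc g) (suc g) 1) (cong (suc g +_) (+-comm (suc g) 1)) ⟩
  suc g + suc (suc g)                   ∎)
  where open ≡-Reasoning

F0-mountain : ∀ L g → F0 (suc L + g) ≡ up L ++ mountain (suc L) g ++ down L
F0-mountain L g = trans (cong (λ z → up (suc L + g) ++ (suc L + g) ∷ z) (++-identityʳ (down (L + g)))) (peak L g)
  where
  peak : ∀ L g → up (suc L + g) ++ (suc L + g) ∷ down (L + g) ≡ up L ++ mountain (suc L) g ++ down L
  peak L zero rewrite +-identityʳ L = ++-assoc (up L) (suc L ∷ []) (suc L ∷ down L)
  peak L (suc g) rewrite +-suc L g | peak (suc L) g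
    | ++-assoc (up L) (suc L ∷ []) (mountain (suc (suc L)) g ++ suc L ∷ down L)
    | ++-assoc (mountain (suc (suc L)) g) (suc L ∷ []) (down L) = refl

mountain-∌ : ∀ {m i} g → i < m → All (_≢ i) (mountain m g)
mountain-∌ {m} g i<m = All.map (λ m≤x x≡i → <-irrefl (sym x≡i) (<-≤-trans i<m m≤x)) (mountain-≥ m g)

breakAt-mountain : ∀ m g ys → breakAt m (mountain m g ++ ys) ≡ ([] , mountain m g ++ ys)
breakAt-mountain m zero ys = breakAt-head m _
breakAt-mountain m (suc g) ys = breakAt-head m _

breakAt-around-mountain : ∀ {L d} xs ys → d ≤ suc L → ∃₂ λ X Y →
    (X ++ Y ≡ xs × ∀ g → breakAt d (xs ++ mountain (suc L) g ++ ys) ≡ (X , Y ++ mountain (suc L) g ++ ys))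
  ⊎ (X ++ Y ≡ ys × ∀ g → breakAt d (xs ++ mountain (suc L) g ++ ys) ≡ (xs ++ mountain (suc L) g ++ X , Y))
breakAt-around-mountain {d = d} (x ∷ xs) ys d≤ with x ≟ d
... | yes refl = [] , x ∷ xs , inj₁ (refl , λ g → breakAt-head x _)
... | no x≢d with breakAt-around-mountain xs ys d≤
...   | X , Y , inj₁ (X++Y , brk) =
  x ∷ X , Y , inj₁ (cong (x ∷_) X++Y , λ g → trans (breakAt-≢ _ x≢d) (cong (Prod.map₁ (x ∷_)) (brk g)))
...   | X , Y , inj₂ (X++Y , brk) =
  X , Y , inj₂ (X++Y , λ g → trans (breakAt-≢ _ x≢d) (cong (Prod.map₁ (x ∷_)) (brk g)))
breakAt-around-mountain {L} {d} [] ys d≤ with d ≟ suc L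
... | yes refl = [] , [] , inj₁ (refl , λ g → breakAt-mountain (suc L) g ys)
... | no d≢ = proj₁ (breakAt d ys) , proj₂ (breakAt d ys) ,
  inj₂ (breakAt-++ d ys , λ g → breakAt-skip _ ys (mountain-∌ g (≤∧≢⇒< d≤ d≢)))

prefix-below : ∀ {m} U c v P w → All (_< m) U → c < m → U ++ c ∷ v ≡ P ++ m ∷ w →
  ∃ λ P₂ → P ≡ U ++ c ∷ P₂
prefix-below [] c v [] w [] c<m eq = ⊥-elim (<-irrefl (proj₁ (∷-injective eq)) c<m)
prefix-below [] c v (p ∷ P) w [] c<m eq with ∷-injective eq
... | refl , _ = P , refl
prefix-below (u ∷ U) c v [] w (u<m ∷ _) c<m eq = ⊥-elim (<-irrefl (proj₁ (∷-injective eq)) u<m)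
prefix-below (u ∷ U) c v (p ∷ P) w (_ ∷ U<m) c<m eq with ∷-injective eq
... | refl , eq′ with prefix-below U c v P w U<m c<m eq′
...   | P₂ , refl = P₂ , refl

suffix-below : ∀ {m} v w P S → All (_< m) w → v ++ w ≡ P ++ m ∷ S → ∃ λ S₂ → S ≡ S₂ ++ w
suffix-below [] w P S w<m refl = ⊥-elim (∉-if-all-< w<m (∈-++⁺ʳ P (here refl)))
suffix-below (x ∷ v) w [] S w<m eq with ∷-injective eq
... | refl , eq′ = v , sym eq′
suffix-below (x ∷ v) w (p ∷ P) S w<m eq = suffix-below v w P S w<m (proj₂ (∷-injective eq))

MountainSplit : ℕ → ℕ → List ℕ → Set
MountainSplit L n r = ∃₂ λ P S → All (_≤ L) P × All (_≤ L) S ×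
  (∀ g → FR n (suc L + g) (r ++ replicate g 0) ≡ P ++ mountain (suc L) g ++ S)

castle-over-mountain : ∀ {L n r β} j c P₂ S₂ → Parent r (suc j) β →
  (∀ g → FR n (suc L + g) (β ++ replicate g 0) ≡ (up j ++ c ∷ P₂) ++ mountain (suc L) g ++ S₂ ++ down (suc j)) →
  ∀ g → let M = P₂ ++ mountain (suc L) g ++ S₂ in
  FR (suc n) (suc L + g) (r ++ replicate g 0) ≡
  up j ++ proj₂ (breakAt (suc c) M) ++ (c ∷ proj₁ (breakAt (suc c) M)) ++ down (suc j)
castle-over-mountain {L} {n} {r} {β} j c P₂ S₂ p splitβ g = begin
  FR (suc n) (suc L + g) (r ++ replicate g 0)             ≡⟨ FR-parent n _ (parent-++ (replicate g 0) p) ⟩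
  castle (suc j) (FR n (suc L + g) (β ++ replicate g 0))  ≡⟨ cong (castle (suc j)) (splitβ g) ⟩
  castle (suc j) ((up j ++ c ∷ P₂) ++ Mt ++ S₂ ++ D)      ≡⟨ cong (castle (suc j)) (regroup (up j)) ⟩
  castle (suc j) (up j ++ (c ∷ P₂ ++ Mt ++ S₂) ++ D)      ≡⟨ castle-nest j c (P₂ ++ Mt ++ S₂) ⟩
  up j ++ proj₂ (breakAt (suc c) (P₂ ++ Mt ++ S₂)) ++ (c ∷ proj₁ (breakAt (suc c) (P₂ ++ Mt ++ S₂))) ++ D ∎
  where
  open ≡-Reasoning
  Mt D : List ℕ
  Mt = mountain (suc L) g
  D = down (suc j)
  regroup : ∀ U → (U ++ c ∷ P₂) ++ Mt ++ S₂ ++ D ≡ U ++ (c ∷ P₂ ++ Mt ++ S₂) ++ D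
  regroup [] rewrite ++-assoc P₂ (Mt ++ S₂) D | ++-assoc Mt S₂ D = refl
  regroup (u ∷ U) = cong (u ∷_) (regroup U)

mountain-split-castle : ∀ {L n r β} j c P₂ S₂ → Parent r (suc j) β →
  j < c → c ≤ L → All (_≤ L) P₂ → All (_≤ L) S₂ →
  (∀ g → FR n (suc L + g) (β ++ replicate g 0) ≡ (up j ++ c ∷ P₂) ++ mountain (suc L) g ++ S₂ ++ down (suc j)) →
  MountainSplit L (suc n) r
mountain-split-castle {L} j c P₂ S₂ p j<c c≤L P₂≤ S₂≤ splitβ
  with frame-≤ j<c c≤L | breakAt-around-mountain {L} P₂ S₂ (s≤s c≤L)
... | up≤ , D≤ | X , Y , inj₁ (refl , brk) =
  up j ++ Y , S₂ ++ c ∷ X ++ down (suc j) , ++⁺ up≤ (++⁻ʳ X P₂≤) , ++⁺ S₂≤ (c≤L ∷ ++⁺ (++⁻ˡ X P₂≤) D≤) ,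
  λ g → trans (castle-over-mountain j c (X ++ Y) S₂ p splitβ g)
    (trans (cong (λ b → up j ++ proj₂ b ++ (c ∷ proj₁ b) ++ down (suc j)) (brk g)) (regroup (mountain (suc L) g)))
  where
  regroup : ∀ Mt → up j ++ (Y ++ Mt ++ S₂) ++ (c ∷ X) ++ down (suc j) ≡
                   (up j ++ Y) ++ Mt ++ S₂ ++ c ∷ X ++ down (suc j)
  regroup Mt rewrite ++-assoc (up j) Y (Mt ++ S₂ ++ c ∷ X ++ down (suc j))
    | ++-assoc Y (Mt ++ S₂) (c ∷ X ++ down (suc j)) | ++-assoc Mt S₂ (c ∷ X ++ down (suc j)) = refl
... | up≤ , D≤ | X , Y , inj₂ (refl , brk) =
  up j ++ Y ++ c ∷ P₂ , X ++ down (suc j) , ++⁺ up≤ (++⁺ (++⁻ʳ X S₂≤) (c≤L ∷ P₂≤)) , ++⁺ (++⁻ˡ X S₂≤) D≤ ,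
  λ g → trans (castle-over-mountain j c P₂ (X ++ Y) p splitβ g)
    (trans (cong (λ b → up j ++ proj₂ b ++ (c ∷ proj₁ b) ++ down (suc j)) (brk g)) (regroup (mountain (suc L) g)))
  where
  regroup : ∀ Mt → up j ++ Y ++ (c ∷ P₂ ++ Mt ++ X) ++ down (suc j) ≡
                   (up j ++ Y ++ c ∷ P₂) ++ Mt ++ X ++ down (suc j)
  regroup Mt rewrite ++-assoc (up j) (Y ++ c ∷ P₂) (Mt ++ X ++ down (suc j))
    | ++-assoc Y (c ∷ P₂) (Mt ++ X ++ down (suc j))
    | ++-assoc P₂ (Mt ++ X) (down (suc j)) | ++-assoc Mt X (down (suc j)) = refl

mountain-split-base : ∀ {L n r P S} → (∀ g → FR n (suc L + g) (r ++ replicate g 0) ≡ P ++ mountain (suc L) g ++ S) →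
  FR n (suc L) r ≡ P ++ suc L ∷ suc L ∷ S
mountain-split-base {L} {n} {r} split =
  trans (cong₂ (FR n) (sym (+-identityʳ (suc L))) (sym (++-identityʳ r))) (split 0)

locate-frame : ∀ {L} j c mid P S → j < c → c ≤ L →
  up j ++ c ∷ mid ++ down (suc j) ≡ P ++ suc L ∷ suc L ∷ S →
  ∃₂ λ P₂ S₂ → P ≡ up j ++ c ∷ P₂ × S ≡ S₂ ++ down (suc j)
locate-frame {L} j c mid P S j<c c≤L eq with frame-≤ j<c c≤L
... | up≤ , D≤ with prefix-below (up j) c (mid ++ down (suc j)) P (suc L ∷ S) (All.map s≤s up≤) (s≤s c≤L) eq
                  | suffix-below (up j ++ c ∷ mid) (down (suc j)) (P ++ suc L ∷ []) S (All.map s≤s D≤) eq′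
  where
  eq′ : (up j ++ c ∷ mid) ++ down (suc j) ≡ (P ++ suc L ∷ []) ++ suc L ∷ S
  eq′ = trans (++-assoc (up j) (c ∷ mid) (down (suc j))) (trans eq (sym (++-assoc P (suc L ∷ []) (suc L ∷ S))))
... | P₂ , P≡ | S₂ , S≡ = P₂ , S₂ , P≡ , S≡

mountain-split : ∀ L n r → sum r ≡ n → Bounded (suc L) 1 r → MountainSplit L n r
mountain-split L zero r _ _ = up L , down L , up-≤ L , down-≤ L , F0-mountain L
mountain-split L (suc n) r sum≡ bounded with parent-exists r sum≡
... | i , β , p with suc-injective (trans (sym (sum-parent p)) sum≡) | bounded-parent (suc L) 1 p bounded
... | sumβ | boundedβ with mountain-split L n β sumβ boundedβ | nest-invariant (suc L) n β sumβ boundedβ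
... | P , S , P≤ , S≤ , splitβ | _ , framed with castling-site p bounded framed
... | j , c , mid , refl , j<c , s≤s c≤L , Fβ≡ , _
  with locate-frame j c mid P S j<c c≤L (trans (sym Fβ≡) (mountain-split-base {n = n} {β} splitβ))
... | P₂ , S₂ , refl , refl =
  mountain-split-castle j c P₂ S₂ p j<c c≤L (All.tail (++⁻ʳ (up j) P≤)) (++⁻ˡ S₂ S≤) splitβ

-- positionsFrom j p xs lists the positions of j in xs, counting from p: it is the helper local
-- to positions in Defs, which cannot be named from outside and is therefore found by unification
-- (after generalising the starting position 0, the equation below is a pattern problem).
mutual
  positionsFrom : ℕ → ℕ → List ℕ → List ℕ
  positionsFrom = _

  positions≡positionsFrom : ∀ j xs → positions j xs ≡ positionsFrom j 0 xs
  positions≡positionsFrom j xs with 0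
  ... | p = refl

positionsFrom-++ : ∀ j p xs ys → positionsFrom j p (xs ++ ys) ≡ positionsFrom j p xs ++ positionsFrom j (p + length xs) ys
positionsFrom-++ j p [] ys rewrite +-identityʳ p = refl
positionsFrom-++ j p (x ∷ xs) ys with x ≡ᵇ j
... | true rewrite positionsFrom-++ j (suc p) xs ys | +-suc p (length xs) = refl
... | false rewrite positionsFrom-++ j (suc p) xs ys | +-suc p (length xs) = refl

positionsFrom-+ : ∀ j q p xs → positionsFrom j (q + p) xs ≡ map (q +_) (positionsFrom j p xs)
positionsFrom-+ j q p [] = refl
positionsFrom-+ j q p (x ∷ xs) with x ≡ᵇ j
... | true = cong ((q + p) ∷_)
  (trans (cong (λ z → positionsFrom j z xs) (sym (+-suc q p))) (positionsFrom-+ j q (suc p) xs))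
... | false = trans (cong (λ z → positionsFrom j z xs) (sym (+-suc q p))) (positionsFrom-+ j q (suc p) xs)

positionsFrom-∉ : ∀ j p xs → All (_≢ j) xs → positionsFrom j p xs ≡ []
positionsFrom-∉ j p [] [] = refl
positionsFrom-∉ j p (x ∷ xs) (x≢j ∷ xs≢j) rewrite ≢⇒≡ᵇ≡false x≢j = positionsFrom-∉ j (suc p) xs xs≢j

widen-range : ∀ {p n} ys → All (λ y → suc p ≤ y × y < suc p + n) ys → All (λ y → p ≤ y × y < p + suc n) ys
widen-range {p} {n} ys = All.map (λ {y} (p<y , y<) → ≤-trans (n≤1+n p) p<y , subst (y <_) (sym (+-suc p n)) y<)

positionsFrom-range : ∀ j p xs → All (λ x → p ≤ x × x < p + length xs) (positionsFrom j p xs)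
positionsFrom-range j p [] = []
positionsFrom-range j p (x ∷ xs) with x ≡ᵇ j
... | true = (≤-refl , m<m+n p (s≤s z≤n)) ∷ widen-range _ (positionsFrom-range j (suc p) xs)
... | false = widen-range _ (positionsFrom-range j (suc p) xs)

positions-around-mountain : ∀ {L} i P S g → i ≤ L →
  positions i (P ++ mountain (suc L) g ++ S) ≡ positionsFrom i 0 P ++ map ((suc g + suc g) +_) (positionsFrom i (length P) S)
positions-around-mountain {L} i P S g i≤L = trans (positions≡positionsFrom i (P ++ mountain (suc L) g ++ S)) split-positions
  where
  split-positions : positionsFrom i 0 (P ++ mountain (suc L) g ++ S) ≡
                    positionsFrom i 0 P ++ map ((suc g + suc g) +_) (positionsFrom i (length P) S)
  split-positions
    rewrite positionsFrom-++ i 0 P (mountain (suc L) g ++ S) | positionsFrom-++ i (length P) (mountain (suc L) g) S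
        | positionsFrom-∉ i (length P) (mountain (suc L) g) (mountain-∌ g (s≤s i≤L))
        | +-comm (length P) (length (mountain (suc L) g)) | length-mountain (suc L) g
    = cong (positionsFrom i 0 P ++_) (positionsFrom-+ i (suc g + suc g) (length P) S)

halfGap : List ℕ → ℕ
halfGap (p ∷ q ∷ _) = (q ∸ p) / 2
halfGap _ = 0

A≡halfGap : ∀ k j α → A k j α ≡ halfGap (positions j (F k α))
A≡halfGap k j α with positions j (F k α)
... | [] = refl
... | p ∷ [] = refl
... | p ∷ q ∷ _ = refl

[n+n+d]/2≡n+d/2 : ∀ n d → (n + n + d) / 2 ≡ n + d / 2
[n+n+d]/2≡n+d/2 zero d = refl
[n+n+d]/2≡n+d/2 (suc n) d = begin
  (suc n + suc n + d) / 2   ≡⟨ cong (λ m → suc (m + d) / 2) (+-suc n n) ⟩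
  suc (suc (n + n + d)) / 2 ≡⟨ m/n≡1+[m∸n]/n {suc (suc (n + n + d))} {2} (s≤s (s≤s z≤n)) ⟩
  suc ((n + n + d) / 2)     ≡⟨ cong suc ([n+n+d]/2≡n+d/2 n d) ⟩
  suc (n + d / 2)           ∎
  where open ≡-Reasoning

-- The half gap between a position p before the mountain and a position s after it grows by one
-- with each unit of height g, and is capped by L because s ≤ 2L.
halfGap-dichotomy : ∀ L (G H : List ℕ) a → All (_< a) G → All (λ x → a ≤ x × x ≤ L + L) H →
  ∃ λ ℓ → (∀ g → halfGap (G ++ map ((suc g + suc g) +_) H) ≡ ℓ)
        ⊎ (∀ g → halfGap (G ++ map ((suc g + suc g) +_) H) + ℓ ≡ suc L + g)
halfGap-dichotomy L (p ∷ q ∷ G) H a _ _ = (q ∸ p) / 2 , inj₁ (λ g → refl)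
halfGap-dichotomy L (p ∷ []) [] a _ _ = 0 , inj₁ (λ g → refl)
halfGap-dichotomy L (p ∷ []) (s ∷ H) a (p<a ∷ []) ((a≤s , s≤2L) ∷ _) = L ∸ (s ∸ p) / 2 , inj₂ grows
  where
  h≤L : (s ∸ p) / 2 ≤ L
  h≤L = begin
    (s ∸ p) / 2     ≤⟨ /-monoˡ-≤ 2 (≤-trans (m∸n≤m s p) s≤2L) ⟩
    (L + L) / 2     ≡⟨ cong (_/ 2) (sym (+-identityʳ (L + L))) ⟩
    (L + L + 0) / 2 ≡⟨ [n+n+d]/2≡n+d/2 L 0 ⟩
    L + 0           ≡⟨ +-identityʳ L ⟩
    L               ∎
    where open ≤-Reasoning
  grows : ∀ g → ((suc g + suc g + s) ∸ p) / 2 + (L ∸ (s ∸ p) / 2) ≡ suc L + g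
  grows g = begin
    ((suc g + suc g + s) ∸ p) / 2 + (L ∸ h)
      ≡⟨ cong (λ z → z / 2 + (L ∸ h)) (+-∸-assoc (suc g + suc g) (≤-trans (<⇒≤ p<a) a≤s)) ⟩
    (suc g + suc g + (s ∸ p)) / 2 + (L ∸ h) ≡⟨ cong (_+ (L ∸ h)) ([n+n+d]/2≡n+d/2 (suc g) (s ∸ p)) ⟩
    suc g + h + (L ∸ h)                     ≡⟨ +-assoc (suc g) h (L ∸ h) ⟩
    suc g + (h + (L ∸ h))                   ≡⟨ cong (suc g +_) (m+[n∸m]≡n h≤L) ⟩
    suc g + L                               ≡⟨ cong suc (+-comm g L) ⟩
    suc L + g                               ∎
    where
    open ≡-Reasoning
    h : ℕ
    h = (s ∸ p) / 2
halfGap-dichotomy L [] (s ∷ q ∷ H) a _ _ =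
  (q ∸ s) / 2 , inj₁ (λ g → cong (_/ 2) ([m+n]∸[m+o]≡n∸o (suc g + suc g) q s))
halfGap-dichotomy L [] (s ∷ []) a _ _ = 0 , inj₁ (λ g → refl)
halfGap-dichotomy L [] [] a _ _ = 0 , inj₁ (λ g → refl)

halfGap-mountain-dichotomy : ∀ {L} i P S → i ≤ L → length P + length S ≡ suc (L + L) →
  ∃ λ ℓ → (∀ g → halfGap (positions i (P ++ mountain (suc L) g ++ S)) ≡ ℓ)
        ⊎ (∀ g → halfGap (positions i (P ++ mountain (suc L) g ++ S)) + ℓ ≡ suc L + g)
halfGap-mountain-dichotomy {L} i P S i≤L |P|+|S|≡
  with halfGap-dichotomy L (positionsFrom i 0 P) (positionsFrom i (length P) S) (length P) before after
  where
  before : All (_< length P) (positionsFrom i 0 P)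
  before = All.map proj₂ (positionsFrom-range i 0 P)
  after : All (λ x → length P ≤ x × x ≤ L + L) (positionsFrom i (length P) S)
  after = All.map (λ {x} (|P|≤x , x<) → |P|≤x , ≤-pred (subst (x <_) |P|+|S|≡ x<))
                  (positionsFrom-range i (length P) S)
... | ℓ , inj₁ constant =
  ℓ , inj₁ (λ g → trans (cong halfGap (positions-around-mountain i P S g i≤L)) (constant g))
... | ℓ , inj₂ grows =
  ℓ , inj₂ (λ g → trans (cong (λ z → halfGap z + ℓ) (positions-around-mountain i P S g i≤L)) (grows g))

bounded-++ : ∀ k p xs ys → Bounded k p xs → Bounded k (p + length xs) ys → Bounded k p (xs ++ ys)
bounded-++ k p [] ys _ ys-bounded rewrite +-identityʳ p = ys-bounded
bounded-++ k p (x ∷ xs) ys (x-bounded , xs-bounded) ys-bounded =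
  x-bounded , bounded-++ k (suc p) xs ys xs-bounded (subst (λ q → Bounded k q ys) (+-suc p (length xs)) ys-bounded)

-- An entry of a restricted growth string exceeds an earlier entry h by at most its distance from h.
linked-bounded : ∀ K h xs → Linked (λ x y → y ≤ suc x) (h ∷ xs) → suc (h + length xs) ≤ K →
  Bounded K 1 (reverse xs)
linked-bounded K h [] _ _ = tt
linked-bounded K h (x ∷ xs) (x≤h+1 ∷ linked) h+|x∷xs|<K =
  subst (Bounded K 1) (sym (unfold-reverse x xs)) (bounded-++ K 1 (reverse xs) (x ∷ []) xs-bounded (x-bounded , tt))
  where
  h+|x∷xs|<K′ : suc (suc (h + length xs)) ≤ K
  h+|x∷xs|<K′ = subst (λ z → suc z ≤ K) (+-suc h (length xs)) h+|x∷xs|<K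
  xs-bounded : Bounded K 1 (reverse xs)
  xs-bounded = linked-bounded K x xs linked (≤-trans (s≤s (+-monoˡ-≤ (length xs) x≤h+1)) h+|x∷xs|<K′)
  x-bounded : suc (length (reverse xs)) + x ≤ K
  x-bounded rewrite length-reverse xs =
    ≤-trans (s≤s (+-monoʳ-≤ (length xs) x≤h+1))
            (subst (λ z → suc z ≤ K) (+-comm (suc h) (length xs)) h+|x∷xs|<K′)

reverse-replicate : ∀ g (x : ℕ) → reverse (replicate g x) ≡ replicate g x
reverse-replicate zero x = refl
reverse-replicate (suc g) x = begin
  reverse (x ∷ replicate g x)         ≡⟨ unfold-reverse x (replicate g x) ⟩
  reverse (replicate g x) ++ x ∷ []   ≡⟨ cong (_++ x ∷ []) (reverse-replicate g x) ⟩
  replicate g x ++ x ∷ []             ≡⟨ snoc g ⟩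
  x ∷ replicate g x                   ∎
  where
  open ≡-Reasoning
  snoc : ∀ g → replicate g x ++ x ∷ [] ≡ x ∷ replicate g x
  snoc zero = refl
  snoc (suc g) = cong (x ∷_) (snoc g)

sum-replicate-0 : ∀ g → sum (replicate g 0) ≡ 0
sum-replicate-0 zero = refl
sum-replicate-0 (suc g) = sum-replicate-0 g

F-pad : ∀ α g → F (suc (length α) + g) (pad (suc (length α) + g) α) ≡
  FR (sum α) (suc (length α) + g) (reverse α ++ replicate g 0)
F-pad α g = begin
  F k (pad k α)
    ≡⟨ cong (λ m → F k (replicate m 0 ++ α)) (m+n∸m≡n (length α) g) ⟩
  FR (sum (replicate g 0 ++ α)) k (reverse (replicate g 0 ++ α))
    ≡⟨ cong₂ (λ n r → FR n k r) sum≡ reverse≡ ⟩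
  FR (sum α) k (reverse α ++ replicate g 0)
    ∎
  where
  open ≡-Reasoning
  k : ℕ
  k = suc (length α) + g
  sum≡ : sum (replicate g 0 ++ α) ≡ sum α
  sum≡ = trans (sum-++ (replicate g 0) α) (cong (_+ sum α) (sum-replicate-0 g))
  reverse≡ : reverse (replicate g 0 ++ α) ≡ reverse α ++ replicate g 0
  reverse≡ = trans (reverse-++ (replicate g 0) α) (cong (reverse α ++_) (reverse-replicate g 0))

mountain-split-length : ∀ {L n r P S} → sum r ≡ n → Bounded (suc L) 1 r →
  FR n (suc L) r ≡ P ++ suc L ∷ suc L ∷ S → length P + length S ≡ suc (L + L)
mountain-split-length {L} {n} {r} {P} {S} sum≡ bounded F≡ = suc-injective (suc-injective (begin
  suc (suc (length P + length S))
    ≡⟨ sym (trans (+-suc (length P) (suc (length S))) (cong suc (+-suc (length P) (length S)))) ⟩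
  length P + suc (suc (length S))             ≡⟨ sym (length-++ P) ⟩
  length (P ++ suc L ∷ suc L ∷ S)             ≡⟨ ↭-length perm ⟩
  length (up L ++ suc L ∷ suc L ∷ down L)     ≡⟨ length-++ (up L) ⟩
  length (up L) + suc (suc (length (down L))) ≡⟨ cong₂ (λ a b → a + suc (suc b)) (length-up L) (length-down L) ⟩
  suc L + suc (suc L)                         ≡⟨ cong suc (trans (+-suc L (suc L)) (cong suc (+-suc L L))) ⟩
  suc (suc (suc (L + L)))                     ∎))
  where
  open ≡-Reasoning
  perm : P ++ suc L ∷ suc L ∷ S ↭ up L ++ suc L ∷ suc L ∷ down L
  perm = ↭-trans (↭-reflexive (sym F≡)) (↭-trans (proj₁ (nest-invariant (suc L) n r sum≡ bounded))
           (↭-reflexive (trans (cong F0 (sym (+-identityʳ (suc L)))) (F0-mountain L 0))))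

iIdx-parent : ∀ α {i β} → Parent (reverse α) i β → iIdx α ≡ i
iIdx-parent α p rewrite stepR-parent p = refl

rgs-bounded : ∀ α → NonNullRGS α → Bounded (suc (length α)) 1 (reverse α)
rgs-bounded α ((_ , refl) , linked) = linked-bounded _ 0 α (s≤s z≤n ∷ linked) ≤-refl

A-padded : ∀ α {i β P S} → Parent (reverse α) i β → let L = length α in
  (∀ g → FR (sum α) (suc L + g) (reverse α ++ replicate g 0) ≡ P ++ mountain (suc L) g ++ S) →
  ∀ g → A (suc L + g) (iIdx α) (pad (suc L + g) α) ≡ halfGap (positions i (P ++ mountain (suc L) g ++ S))
A-padded α p split g = trans (A≡halfGap (suc (length α) + g) (iIdx α) (pad (suc (length α) + g) α))
  (cong₂ (λ j w → halfGap (positions j w)) (iIdx-parent α p) (trans (F-pad α g) (split g)))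

padded-A-dichotomy : ∀ α → NonNullRGS α → let L = length α in
  ∃ λ ℓ → (∀ g → A (suc L + g) (iIdx α) (pad (suc L + g) α) ≡ ℓ)
        ⊎ (∀ g → A (suc L + g) (iIdx α) (pad (suc L + g) α) + ℓ ≡ suc L + g)
padded-A-dichotomy α@(1 ∷ rest) rgs@((rest , refl) , _)
  with parent-exists (reverse α) (sum-↭ (↭-reverse α))
     | mountain-split (length α) (sum α) (reverse α) (sum-↭ (↭-reverse α)) (rgs-bounded α rgs)
... | i , β , p | P , S , _ , _ , split
  with halfGap-mountain-dichotomy i P S i≤L (mountain-split-length {P = P} {S} (sum-↭ (↭-reverse α)) (rgs-bounded α rgs)
                                              (mountain-split-base {n = sum α} {reverse α} {P} {S} split))
  where
  i≤L : i ≤ length α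
  i≤L = subst (i ≤_) (length-reverse α) (parent-index-≤ p)
... | ℓ , inj₁ constant = ℓ , inj₁ (λ g → trans (A-padded α {P = P} {S} p split g) (constant g))
... | ℓ , inj₂ grows = ℓ , inj₂ (λ g → trans (cong (_+ ℓ) (A-padded α {P = P} {S} p split g)) (grows g))

beyond-from-offsets : ∀ {L} {Q : ℕ → Set} → (∀ g → Q (suc L + g)) → ∀ k → L < k → Q k
beyond-from-offsets {L} {Q} Q-offsets k L<k = subst Q (m+[n∸m]≡n L<k) (Q-offsets (k ∸ suc L))

theorem8 : (α : List ℕ) → NonNullRGS α →
    ∃ λ (ℓ : ℕ) →
      ((k : ℕ) → length α < k → A k (iIdx α) (pad k α) ≡ ℓ)
      ⊎ ((k : ℕ) → length α < k → A k (iIdx α) (pad k α) + ℓ ≡ k)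
theorem8 α rgs with padded-A-dichotomy α rgs
... | ℓ , inj₁ constant = ℓ , inj₁ (beyond-from-offsets constant)
... | ℓ , inj₂ grows = ℓ , inj₂ (beyond-from-offsets grows)
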